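{- Let $\langle\phi,\vec{a}\rangle$ be a loop. If $\langle \vec{x}'=\vec{a}^n(\vec{x}) \mid \mathit{true} \mid \phi(\vec{x})\rangle_{\vec{a}} \leadsto^* \langle \psi(\vec{y}) \mid \check\phi(\vec{x}) \mid \mathit{true}\rangle_{\vec{a}}$, then $\psi$ approximates $\langle\phi,\vec{a}\rangle$. If $\langle \vec{x}'=\vec{a}^n(\vec{x}) \mid \mathit{true} \mid \phi(\vec{x})\rangle_{\vec{a}} \leadsto_e^* \langle \psi(\vec{y}) \mid \check\phi(\vec{x}) \mid \mathit{true}\rangle_{\vec{a}}$, then $\psi$ is equivalent to $\langle\phi,\vec{a}\rangle$.
   Context: Fix $d \ge 1$, integer-valued variables $\vec{x}=(x_1,\dots,x_d)$, a variable $n$, and primed variables $\vec{x}'$; write $\vec{y}=(\vec{x},n,\vec{x}')$. $\vec{a}^n$ denotes $n$-fold application of $\vec{a}$ ($\vec{a}^0=\mathrm{id}$). Formulas are finite quantifier-free propositional formulas with atoms $p>0$, $p$ a closed-form arithmetic expression; formulas are in CNF and identified with their sets of clauses ($\cup$ = conjunction, $\setminus$ = clause removal). A loop $\langle \phi,\vec{a}\rangle$ consists of a formula $\phi$ over $\vec{x}$ and $\vec{a}:\mathbb{Z}^d\to\mathbb{Z}^d$ given by closed-form expressions; $\vec{x}\longrightarrow_{\langle\phi,\vec{a}\rangle}\vec{x}'$ iff $\phi(\vec{x})\land\vec{x}'=\vec{a}(\vec{x})$, and $\longrightarrow^n$ is the $n$-fold composition. A formula $\psi$ over $\vec{y}$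 approximates the loop if for all $n>0$, $\vec{x},\vec{x}'\in\mathbb{Z}^d$: $\psi\implies \vec{x}\longrightarrow^n_{\langle\phi,\vec{a}\rangle}\vec{x}'$; it is equivalent to the loop if $\psi\iff \vec{x}\longrightarrow^n_{\langle\phi,\vec{a}\rangle}\vec{x}'$ for all $n>0$. A conditional acceleration technique is a partial function $\mathit{accel}$ from pairs (loop $\langle\chi,\vec{a}\rangle$, formula $\check\phi$ over $\vec{x}$) to formulas over $\vec{y}$; it is sound if for all arguments in its domain, all $\vec{x},\vec{x}'$ and $n>0$, $\vec{x}\longrightarrow^n_{\langle\check\phi,\vec{a}\rangle}\vec{x}'\land\mathit{accel}(\langle\chi,\vec{a}\rangle,\check\phi)$ implies $\vec{x}\longrightarrow^n_{\langle\chi,\vec{a}\rangle}\vec{x}'$, and exact if moreover $\vec{x}\longrightarrow^n_{\langle\chi\land\check\phi,\vec{a}\rangle}\vec{x}'$ implies $\mathit{accel}(\langle\chi,\vec{a}\rangle,\check\phi)$. An acceleration problem is a tuple $\langle \psi \mid \check\phi \mid \hat\phi\rangle_{\vec{a}}$ ($\psi$ over $\vec{y}$; $\check\phi,\hat\phi$ over $\vec{x}$). The relation $\leadsto$: $\langle \psi_1 \mid \check\phi \mid \hat\phi\rangle_{\vec{a}} \leadsto \langle \psi_1\cup\psi_2 \mid \check\phi\cup\chi \mid \hat\phi\setminus\chi\rangle_{\vec{a}}$ whenever $\emptyset\ne\chi\subseteq\hat\phi$ and $\mathit{accel}(\langle\chi,\vec{a}\rangle,\check\phi)=\psi_2$ for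 a sound conditional acceleration technique $\mathit{accel}$; the step is written $\leadsto_e$ if $\mathit{accel}$ is exact. $\leadsto^*$, $\leadsto_e^*$ denote reflexive-transitive closures. -}

module Defs where

open import Data.Nat using (ℕ; zero; suc; _>_)
open import Data.Integer using (ℤ; _+_; _-_; +_) renaming (_>_ to _>ℤ_)
open import Data.Fin using (Fin)
open import Data.Vec using (Vec; lookup)
open import Data.List using (List; []; _∷_; _++_; map; allFin)
import Data.List
open import Data.List.Membership.Propositional using (_∈_)
open import Data.List.Relation.Unary.All using (All)
open import Data.List.Relation.Unary.Any using (Any)
open import Data.Product using (Σ; _×_; _,_; ∃)
open import Data.Maybe using (Maybe; just)
open import Data.Unit using (⊤)
open import Data.Empty using (⊥)
open import Relation.Nullary using (¬_)
open import Relation.Binary.PropositionalEquality using (_≡_)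
open import Function using (_⇔_)

X : ℕ → Set
X d = Vec ℤ d

-- valuations of y⃗ = (x⃗, n, x⃗')
Y : ℕ → Set
Y d = X d × ℕ × X d

-- Formulas in CNF, identified with their (finite) sets of clauses.
-- An atom  p > 0  is represented by the arithmetic expression p,
-- i.e. by its value as a function of the valuation.

Atom : Set → Set
Atom V = V → ℤ

Clause : Set → Set
Clause V = List (Atom V)

Formula : Set → Set
Formula V = List (Clause V)

true : ∀ {V} → Formula V
true = []

_∪_ : ∀ {V} → Formula V → Formula V → Formula V
_∪_ = _++_

_⊆_ : ∀ {V} → Formula V → Formula V → Set
χ ⊆ φ = ∀ {c} → c ∈ χ → c ∈ φ

IsDiff : ∀ {V} → Formula V → Formula V → Formula V → Set
IsDiff φ χ φ₂ = ∀ c → (c ∈ φ₂) ⇔ (c ∈ φ × ¬ (c ∈ χ))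

NonEmpty : ∀ {V} → Formula V → Set
NonEmpty [] = ⊥
NonEmpty (_ ∷ _) = ⊤

⟦_⟧a : ∀ {V} → Atom V → V → Set
⟦ p ⟧a v = p v >ℤ + 0

⟦_⟧c : ∀ {V} → Clause V → V → Set
⟦ c ⟧c v = Any (λ p → ⟦ p ⟧a v) c

⟦_⟧ : ∀ {V} → Formula V → V → Set
⟦ φ ⟧ v = All (λ c → ⟦ c ⟧c v) φ

Update : ℕ → Set
Update d = X d → X d

record Loop (d : ℕ) : Set where
  constructor ⟨_,_⟩
  field
    guard  : Formula (X d)
    update : Update d

iter : ∀ {d} → Update d → ℕ → X d → X d
iter a zero    x = x
iter a (suc n) x = iter a n (a x)

Steps : ∀ {d} → Loop d → ℕ → X d → X d → Set
Steps L zero    x x' = x ≡ x'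
Steps L (suc n) x x' = ⟦ Loop.guard L ⟧ x × Steps L n (Loop.update L x) x'

Approximates : ∀ {d} → Formula (Y d) → Loop d → Set
Approximates ψ L = ∀ n x x' → n > 0 → ⟦ ψ ⟧ (x , n , x') → Steps L n x x'

Equivalent : ∀ {d} → Formula (Y d) → Loop d → Set
Equivalent ψ L = ∀ n x x' → n > 0 → ⟦ ψ ⟧ (x , n , x') ⇔ Steps L n x x'

Accel : ℕ → Set
Accel d = Loop d → Formula (X d) → Maybe (Formula (Y d))

Sound : ∀ {d} → Accel d → Set
Sound accel = ∀ χ a φc ψ → accel ⟨ χ , a ⟩ φc ≡ just ψ →
  ∀ x x' n → n > 0 →
  Steps ⟨ φc , a ⟩ n x x' → ⟦ ψ ⟧ (x , n , x') → Steps ⟨ χ , a ⟩ n x x'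

ExactAccel : ∀ {d} → Accel d → Set
ExactAccel accel = Sound accel × (∀ χ a φc ψ → accel ⟨ χ , a ⟩ φc ≡ just ψ →
  ∀ x x' n → n > 0 →
  Steps ⟨ χ ∪ φc , a ⟩ n x x' → ⟦ ψ ⟧ (x , n , x'))

record Problem (d : ℕ) : Set where
  constructor ⟨_∣_∣_⟩
  field
    ψ    : Formula (Y d)
    φchk : Formula (X d)
    φhat : Formula (X d)

data StepWith {d} (Good : Accel d → Set) (a : Update d) : Problem d → Problem d → Set where
  step : ∀ {ψ₁ φc φh} (χ : Formula (X d)) (ψ₂ : Formula (Y d)) (φh' : Formula (X d))
         (accel : Accel d) → Good accel →
         NonEmpty χ → χ ⊆ φh →
         accel ⟨ χ , a ⟩ φc ≡ just ψ₂ →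
         IsDiff φh χ φh' →
         StepWith Good a ⟨ ψ₁ ∣ φc ∣ φh ⟩ ⟨ ψ₁ ∪ ψ₂ ∣ φc ∪ χ ∣ φh' ⟩

data Star {d} (R : Problem d → Problem d → Set) : Problem d → Problem d → Set where
  ε   : ∀ {P} → Star R P P
  _◅_ : ∀ {P Q S} → R P Q → Star R Q S → Star R P S

_⇝*_ : ∀ {d} {a : Update d} → Problem d → Problem d → Set
_⇝*_ {a = a} = Star (StepWith Sound a)

_⇝ₑ*_ : ∀ {d} {a : Update d} → Problem d → Problem d → Set
_⇝ₑ*_ {a = a} = Star (StepWith ExactAccel a)

-- the formula  x⃗' = a⃗ⁿ(x⃗)  over y⃗, in CNF:
-- for each i,  x'ᵢ - (aⁿ x)ᵢ + 1 > 0  and  (aⁿ x)ᵢ - x'ᵢ + 1 > 0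

iterEq : ∀ {d} → Update d → Formula (Y d)
iterEq {d} a = Data.List.concatMap clauses (allFin d)
  where
  clauses : Fin d → Formula (Y d)
  clauses i =
      ((λ { (x , n , x') → (lookup x' i - lookup (iter a n x) i) + + 1 }) ∷ [])
    ∷ ((λ { (x , n , x') → (lookup (iter a n x) i - lookup x' i) + + 1 }) ∷ [])
    ∷ []

-- Both parts follow from an invariant of acceleration problems ⟨ ψ ∣ φ̌ ∣ φ̂ ⟩
-- that holds initially and is preserved by every step.  For ⇝ it says that ψ
-- implies the run of ⟨ φ̌ , a ⟩ and that φ̌ ∧ φ̂ implies φ: a step moves χ from
-- φ̂ to φ̌ and soundness of the technique adds exactly the run of ⟨ χ , a ⟩.
-- For ⇝ₑ it says dually that the run of ⟨ φ , a ⟩ implies ψ and that φ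
-- implies φ̌ ∧ φ̂.  In a final problem φ̂ = true, so the invariants yield the
-- two directions of the theorem.
module Submission where

open import Defs
open import Data.Nat using (ℕ; _≥_; zero; suc; z≤n; s≤s) renaming (_>_ to _>ℕ_)
open import Data.Product using (_×_; _,_; proj₁; proj₂)
open import Data.Integer using (ℤ; +_; -[1+_]; +≤+; +<+; _≤_; _<_; _-_) renaming (_+_ to _+ℤ_)
open import Data.Integer.Properties using (≤-antisym; 0≤i-j⇒j≤i; +-inverseʳ; _<?_)
open import Data.Vec using (Vec; lookup; tabulate)
open import Data.Vec.Properties using (tabulate∘lookup; tabulate-cong)
open import Data.List using ([]; _∷_; allFin)
open import Data.List.Relation.Unary.All as All using ([]; _∷_)
import Data.List.Relation.Unary.All.Properties as All
open import Data.List.Relation.Unary.Any using (any?; here)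
open import Data.List.Membership.Propositional.Properties using (∈-allFin)
open import Relation.Nullary.Decidable using (decidable-stable)
open import Relation.Binary.PropositionalEquality using (_≡_; refl; sym; module ≡-Reasoning)
open import Function using (_⇔_; mk⇔; Equivalence)
open Equivalence using (to; from)

0<i+1⇒0≤i : ∀ i → + 0 < i +ℤ + 1 → + 0 ≤ i
0<i+1⇒0≤i (+ n)          _          = +≤+ z≤n
0<i+1⇒0≤i -[1+ zero ]    (+<+ ())
0<i+1⇒0≤i -[1+ suc n ]   ()

0<[i-j]+1∧0<[j-i]+1⇒i≡j : ∀ i j → + 0 < (i - j) +ℤ + 1 → + 0 < (j - i) +ℤ + 1 → i ≡ j
0<[i-j]+1∧0<[j-i]+1⇒i≡j i j p q =
  ≤-antisym (0≤i-j⇒j≤i (0<i+1⇒0≤i (j - i) q)) (0≤i-j⇒j≤i (0<i+1⇒0≤i (i - j) p))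

0<[i-i]+1 : ∀ i → + 0 < (i - i) +ℤ + 1
0<[i-i]+1 i rewrite +-inverseʳ i = +<+ (s≤s z≤n)

lookup-ext : ∀ {n} (u w : Vec ℤ n) → (∀ i → lookup u i ≡ lookup w i) → u ≡ w
lookup-ext u w eq = begin
  u                   ≡⟨ sym (tabulate∘lookup u) ⟩
  tabulate (lookup u) ≡⟨ tabulate-cong eq ⟩
  tabulate (lookup w) ≡⟨ tabulate∘lookup w ⟩
  w                   ∎
  where open ≡-Reasoning

module _ {V : Set} where

  ⟦⟧-⊆ : ∀ {φ χ : Formula V} {v} → χ ⊆ φ → ⟦ φ ⟧ v → ⟦ χ ⟧ v
  ⟦⟧-⊆ = All.anti-mono

  ⟦⟧-diff : ∀ {φ χ φ∖χ : Formula V} {v} → IsDiff φ χ φ∖χ → ⟦ φ ⟧ v → ⟦ φ∖χ ⟧ v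
  ⟦⟧-diff diff ⟦φ⟧ = All.tabulate λ {c} c∈φ∖χ → All.lookup ⟦φ⟧ (proj₁ (to (diff c) c∈φ∖χ))

  -- Membership of a clause in χ is undecidable (atoms are functions), but the
  -- truth of a clause is decidable, so it can be recovered from its double negation.
  ⟦⟧-undiff : ∀ {φ χ φ∖χ : Formula V} {v} →
    IsDiff φ χ φ∖χ → ⟦ χ ⟧ v → ⟦ φ∖χ ⟧ v → ⟦ φ ⟧ v
  ⟦⟧-undiff {v = v} diff ⟦χ⟧ ⟦φ∖χ⟧ = All.tabulate λ {c} c∈φ →
    decidable-stable (any? (λ p → + 0 <? p v) c) λ ¬⟦c⟧ →
      ¬⟦c⟧ (All.lookup ⟦φ∖χ⟧ (from (diff c) (c∈φ , λ c∈χ → ¬⟦c⟧ (All.lookup ⟦χ⟧ c∈χ))))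

module _ {d : ℕ} (a : Update d) where

  Steps-mono : ∀ {φ χ : Formula (X d)} → (∀ x → ⟦ φ ⟧ x → ⟦ χ ⟧ x) →
    ∀ n x x' → Steps ⟨ φ , a ⟩ n x x' → Steps ⟨ χ , a ⟩ n x x'
  Steps-mono φ⇒χ zero    x x' x≡x'       = x≡x'
  Steps-mono φ⇒χ (suc n) x x' (⟦φ⟧ , run) = φ⇒χ x ⟦φ⟧ , Steps-mono φ⇒χ n (a x) x' run

  Steps-∪ : ∀ (φ χ : Formula (X d)) n x x' →
    Steps ⟨ φ , a ⟩ n x x' → Steps ⟨ χ , a ⟩ n x x' → Steps ⟨ φ ∪ χ , a ⟩ n x x'
  Steps-∪ φ χ zero    x x' x≡x'        _             = x≡x'
  Steps-∪ φ χ (suc n) x x' (⟦φ⟧ , runφ) (⟦χ⟧ , runχ) =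
    All.++⁺ ⟦φ⟧ ⟦χ⟧ , Steps-∪ φ χ n (a x) x' runφ runχ

  Steps-true⇔ : ∀ n x x' → Steps ⟨ true , a ⟩ n x x' ⇔ (x' ≡ iter a n x)
  Steps-true⇔ zero    x x' = mk⇔ sym sym
  Steps-true⇔ (suc n) x x' = mk⇔ (λ (_ , run) → to (Steps-true⇔ n (a x) x') run)
                                 (λ eq → [] , from (Steps-true⇔ n (a x) x') eq)

  ⟦iterEq⟧⇔ : ∀ n x x' → ⟦ iterEq a ⟧ (x , n , x') ⇔ (x' ≡ iter a n x)
  ⟦iterEq⟧⇔ n x x' = mk⇔ sound complete
    where
    sound : ⟦ iterEq a ⟧ (x , n , x') → x' ≡ iter a n x
    sound ⟦iterEq⟧ = lookup-ext x' (iter a n x) λ i →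
      coordinate i (All.lookup (All.map⁻ (All.concat⁻ ⟦iterEq⟧)) (∈-allFin i))
      where
      coordinate : ∀ i → ⟦ _ ∷ _ ∷ [] ⟧ (x , n , x') → lookup x' i ≡ lookup (iter a n x) i
      coordinate i (here p ∷ here q ∷ []) = 0<[i-j]+1∧0<[j-i]+1⇒i≡j _ _ p q
    complete : x' ≡ iter a n x → ⟦ iterEq a ⟧ (x , n , x')
    complete refl = All.concat⁺ (All.map⁺ {xs = allFin d} (All.tabulate λ {i} _ →
      here (0<[i-i]+1 (lookup x' i)) ∷ here (0<[i-i]+1 (lookup x' i)) ∷ []))

  ⟦iterEq⟧⇔Steps-true : ∀ n x x' → ⟦ iterEq a ⟧ (x , n , x') ⇔ Steps ⟨ true , a ⟩ n x x'
  ⟦iterEq⟧⇔Steps-true n x x' =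
    mk⇔ (λ h → from (Steps-true⇔ n x x') (to (⟦iterEq⟧⇔ n x x') h))
        (λ run → from (⟦iterEq⟧⇔ n x x') (to (Steps-true⇔ n x x') run))

Star-preserves : ∀ {d} {R : Problem d → Problem d → Set} (I : Problem d → Set) →
  (∀ {P Q} → R P Q → I P → I Q) → ∀ {P Q} → Star R P Q → I P → I Q
Star-preserves I preserve ε        i = i
Star-preserves I preserve (r ◅ rs) i = Star-preserves I preserve rs (preserve r i)

Star-map : ∀ {d} {R S : Problem d → Problem d → Set} →
  (∀ {P Q} → R P Q → S P Q) → ∀ {P Q} → Star R P Q → Star S P Q
Star-map f ε        = ε
Star-map f (r ◅ rs) = f r ◅ Star-map f rs

module _ {d : ℕ} (φ : Formula (X d)) (a : Update d) where

  record SoundInvariant (P : Problem d) : Set where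
    field
      ψ⇒Steps-φchk : ∀ n x x' → n >ℕ 0 →
        ⟦ Problem.ψ P ⟧ (x , n , x') → Steps ⟨ Problem.φchk P , a ⟩ n x x'
      φchk∧φhat⇒φ : ∀ x → ⟦ Problem.φchk P ⟧ x → ⟦ Problem.φhat P ⟧ x → ⟦ φ ⟧ x

  record ExactInvariant (P : Problem d) : Set where
    field
      Steps-φ⇒ψ : ∀ n x x' → n >ℕ 0 →
        Steps ⟨ φ , a ⟩ n x x' → ⟦ Problem.ψ P ⟧ (x , n , x')
      φ⇒φchk∧φhat : ∀ x → ⟦ φ ⟧ x → ⟦ Problem.φchk P ⟧ x × ⟦ Problem.φhat P ⟧ x

  SoundInvariant-init : SoundInvariant ⟨ iterEq a ∣ true ∣ φ ⟩
  SoundInvariant-init = record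
    { ψ⇒Steps-φchk = λ n x x' _ → to (⟦iterEq⟧⇔Steps-true a n x x')
    ; φchk∧φhat⇒φ  = λ x _ ⟦φ⟧ → ⟦φ⟧
    }

  ExactInvariant-init : ExactInvariant ⟨ iterEq a ∣ true ∣ φ ⟩
  ExactInvariant-init = record
    { Steps-φ⇒ψ   = λ n x x' _ run →
        from (⟦iterEq⟧⇔Steps-true a n x x') (Steps-mono a (λ _ _ → []) n x x' run)
    ; φ⇒φchk∧φhat = λ x ⟦φ⟧ → [] , ⟦φ⟧
    }

  SoundInvariant-step : ∀ {P Q} → StepWith Sound a P Q → SoundInvariant P → SoundInvariant Q
  SoundInvariant-step (step {ψ₁} {φchk} χ ψ₂ _ _ sound _ _ accel≡ diff) inv = record
    { ψ⇒Steps-φchk = λ n x x' n>0 ⟦ψ₁∪ψ₂⟧ →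
        let ⟦ψ₁⟧ , ⟦ψ₂⟧ = All.++⁻ ψ₁ ⟦ψ₁∪ψ₂⟧
            run = ψ⇒Steps-φchk n x x' n>0 ⟦ψ₁⟧
        in Steps-∪ a φchk χ n x x' run (sound χ a φchk ψ₂ accel≡ x x' n n>0 run ⟦ψ₂⟧)
    ; φchk∧φhat⇒φ = λ x ⟦φchk∪χ⟧ ⟦φhat∖χ⟧ →
        let ⟦φchk⟧ , ⟦χ⟧ = All.++⁻ φchk ⟦φchk∪χ⟧
        in φchk∧φhat⇒φ x ⟦φchk⟧ (⟦⟧-undiff diff ⟦χ⟧ ⟦φhat∖χ⟧)
    }
    where open SoundInvariant inv

  ExactInvariant-step : ∀ {P Q} → StepWith ExactAccel a P Q → ExactInvariant P → ExactInvariant Q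
  ExactInvariant-step (step {φc = φchk} χ ψ₂ _ _ exact _ χ⊆φhat accel≡ diff) inv = record
    { Steps-φ⇒ψ = λ n x x' n>0 run →
        All.++⁺ (Steps-φ⇒ψ n x x' n>0 run)
                (proj₂ exact χ a φchk ψ₂ accel≡ x x' n n>0
                  (Steps-mono a (λ y ⟦φ⟧ → All.++⁺ (⟦χ⟧ y ⟦φ⟧) (proj₁ (φ⇒φchk∧φhat y ⟦φ⟧)))
                    n x x' run))
    ; φ⇒φchk∧φhat = λ x ⟦φ⟧ →
        let ⟦φchk⟧ , ⟦φhat⟧ = φ⇒φchk∧φhat x ⟦φ⟧
        in All.++⁺ ⟦φchk⟧ (⟦χ⟧ x ⟦φ⟧) , ⟦⟧-diff diff ⟦φhat⟧
    }
    where
    open ExactInvariant inv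
    ⟦χ⟧ : ∀ x → ⟦ φ ⟧ x → ⟦ χ ⟧ x
    ⟦χ⟧ x ⟦φ⟧ = ⟦⟧-⊆ χ⊆φhat (proj₂ (φ⇒φchk∧φhat x ⟦φ⟧))

  exact⇒sound : ∀ {P Q} → StepWith ExactAccel a P Q → StepWith Sound a P Q
  exact⇒sound (step χ ψ₂ φh' accel exact ne sub eq diff) =
    step χ ψ₂ φh' accel (proj₁ exact) ne sub eq diff

  ⇝*-approximates : ∀ ψ φc → _⇝*_ {a = a} ⟨ iterEq a ∣ true ∣ φ ⟩ ⟨ ψ ∣ φc ∣ true ⟩ →
    Approximates ψ ⟨ φ , a ⟩
  ⇝*-approximates ψ φc steps n x x' n>0 ⟦ψ⟧ =
    Steps-mono a (λ y ⟦φc⟧ → φchk∧φhat⇒φ y ⟦φc⟧ []) n x x' (ψ⇒Steps-φchk n x x' n>0 ⟦ψ⟧)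
    where
    open SoundInvariant
      (Star-preserves SoundInvariant SoundInvariant-step steps SoundInvariant-init)

  ⇝ₑ*-complete : ∀ ψ φc → _⇝ₑ*_ {a = a} ⟨ iterEq a ∣ true ∣ φ ⟩ ⟨ ψ ∣ φc ∣ true ⟩ →
    ∀ n x x' → n >ℕ 0 → Steps ⟨ φ , a ⟩ n x x' → ⟦ ψ ⟧ (x , n , x')
  ⇝ₑ*-complete ψ φc steps = ExactInvariant.Steps-φ⇒ψ
    (Star-preserves ExactInvariant ExactInvariant-step steps ExactInvariant-init)

theorem5 : ∀ {d : ℕ} → d ≥ 1 → (φ : Formula (X d)) (a : Update d) →
    (∀ (ψ : Formula (Y d)) (φc : Formula (X d)) →
       _⇝*_ {a = a} ⟨ iterEq a ∣ true ∣ φ ⟩ ⟨ ψ ∣ φc ∣ true ⟩ →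
       Approximates ψ ⟨ φ , a ⟩)
    × (∀ (ψ : Formula (Y d)) (φc : Formula (X d)) →
       _⇝ₑ*_ {a = a} ⟨ iterEq a ∣ true ∣ φ ⟩ ⟨ ψ ∣ φc ∣ true ⟩ →
       Equivalent ψ ⟨ φ , a ⟩)
theorem5 _ φ a =
    ⇝*-approximates φ a
  , λ ψ φc steps n x x' n>0 → mk⇔
      (⇝*-approximates φ a ψ φc (Star-map (exact⇒sound φ a) steps) n x x' n>0)
      (⇝ₑ*-complete φ a ψ φc steps n x x' n>0)
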